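{- Let $N\geq\ell\geq k\geq 4$ be integers and fix $I\in[\ell]^{(k-1)}$ with $1\in I$. Let $c:[N]^{(k-1)}\to\mathbb{Z}_4$ be a coloring and $\chi_c:[2^N]^{(k)}\to\mathbb{Z}_4$ the induced coloring. Let $Y=\{y_0<y_1<\dots<y_\ell\}\subseteq[2^N]$ satisfy: (a) $Y$ forms a right comb; (b) for every $J\in\{2,\dots,\ell\}^{(k-1)}$ there is a leaf $y_J$ with $y_0\leq y_J\leq y_1$ (different $J$ may give the same $y_J$); (c) there is a leaf $y_I$ with $y_0\leq y_I<y_1$ and $a(y_I,y_1)=u_Y=a(y_0,y_1)$. If there exists $\alpha\in\mathbb{Z}_4$ such that $\chi_c(\{y_J\}\cup\{y_i:i\in J\})=\alpha$ for every $J\in\{2,\dots,\ell\}^{(k-1)}\cup\{I\}$, then there is an ordered $(k-1)$-graph $(F,<)\in\mathcal{F}^{(k-1)}_{I'}(\ell-1)$, with $I'=I\setminus\{\max I\}$, whose vertex set is a subset of $[N]$ with its natural order, all of whose edges lie in $c^{ -1}(\alpha)$, and whose distinguished set of vertices is $\pi(Y)$.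
   Context: Identify each $x\in[2^N]$ with the binary string of length $N$ representing $x-1$; these are the leaves, in left-to-right order, of the complete binary tree $T(N)$ with levels $1$ (root) to $N+1$ (leaves), a vertex at level $d$ corresponding to a binary string of length $d-1$. For distinct leaves $x,y$, $a(x,y)$ is their greatest common ancestor (their longest common prefix) and $\delta(x,y)$ its level (one plus the length of the longest common prefix). For a set $X$ of at least two leaves let $u_X=a(\min X,\max X)$, and let $X_L(u_X)$ (resp. $X_R(u_X)$) be the elements of $X$ in the subtree of the left (resp. right) child of $u_X$. For $X=\{x_1<\dots<x_t\}$ let $\pi(X)=\{\delta(x_{i-1},x_i):2\leq i\leq t\}\subseteq[N]$. For $t\geq 3$, $X$ forms a left comb if $\delta(x_1,x_2)>\dots>\delta(x_{t-1},x_t)$, and a right comb if $\delta(x_1,x_2)<\dots<\delta(x_{t-1},x_t)$. If $X$ is neither, it forms an $(\ell',r)$-split where $\ell'=|X_L(u_X)|$, $r=|X_R(u_X)|$; balanced if $\ell',r\geq 2$. Induced coloring for $k\geq 4$: $\chi_c(X)=3-c(\pi(X))$ if $X$ is a left comb, $c(\pi(X))$ if a right comb, $0$ if a balanced split, $1$ if a $(k-1,1)$-split, $2$ if a $(1,k-1)$-split (arithmetic in $\mathbb{Z}_4$). An ordered $k'$-graph is a $k'$-uniform hypergraph with a linear order on its vertices. For integers $k',n'\geq 3$ and $I''\in[n']^{(k'-1)}$ with $1\in I''$, $\mathcal{F}_{I''}^{(k')}(n')$ is the family of ordered $k'$-graphs $(F,<)$ with $V(F)=\{x_0,\dots,x_{n'}\}\cup\{x_J:J\in\{2,\dots,n'\}^{(k'-1)}\cup\{I''\}\}$,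 where $x_0<x_1<\dots<x_{n'}$ are distinct, $x_{I''}=x_0$, and $x_0\leq x_J\leq x_1$ for each $J\in\{2,\dots,n'\}^{(k'-1)}$ (different $J$ may give the same vertex, and $x_J$ may equal $x_0$ or $x_1$), and with edge set $\{\{x_J\}\cup\{x_j:j\in J\}:J\in\{2,\dots,n'\}^{(k'-1)}\cup\{I''\}\}$. The set $\{x_0,\dots,x_{n'}\}$ is its distinguished set of vertices. -}

module Defs where

open import Data.Nat using (ℕ; zero; suc; _+_; _∸_; _^_; _≤_; _<_; _>_; _≤?_; _<?_; _>?_; _≟_)
open import Data.Bool using (Bool; true; false; if_then_else_; not)
open import Data.Vec using (Vec; []; _∷_)
open import Data.List using (List; []; _∷_; length; reverse; filter; map; upTo)
open import Data.List.Relation.Unary.Linked using (Linked; linked?)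
open import Data.List.Relation.Unary.All using (All)
open import Data.Fin using (Fin; toℕ) renaming (zero to fz; suc to fs)
open import Data.Nat.DivMod using (_mod_)
open import Data.Product using (_×_)
open import Relation.Nullary using (yes; no; does; _×-dec_)
open import Relation.Binary.PropositionalEquality using (_≡_)
import Data.List.Membership.Propositional
import Data.Bool
import Data.Nat
import Relation.Nullary

-- Leaves of T(N).  The leaf x ∈ [2^N] is identified with the binary
-- string (big-endian, length N) of x - 1; we work with the strings.

Leaf : ℕ → Set
Leaf N = Vec Bool N

val : ∀ {n} → Vec Bool n → ℕ
val {suc n} (b ∷ s) = (if b then 2 ^ n else 0) + val s
val {zero}  []      = 0

_<ᴸ_ : ∀ {n} → Vec Bool n → Vec Bool n → Set
x <ᴸ y = val x < val y

_≤ᴸ_ : ∀ {n} → Vec Bool n → Vec Bool n → Set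
x ≤ᴸ y = val x ≤ val y

-- a(x,y): greatest common ancestor = longest common prefix (a vertex of T(N))
gca : ∀ {n} → Vec Bool n → Vec Bool n → List Bool
gca []          []          = []
gca (false ∷ x) (false ∷ y) = false ∷ gca x y
gca (true ∷ x)  (true ∷ y)  = true ∷ gca x y
gca (false ∷ x) (true ∷ y)  = []
gca (true ∷ x)  (false ∷ y) = []

-- δ(x,y): level of a(x,y) = 1 + length of the longest common prefix
δ : ∀ {n} → Vec Bool n → Vec Bool n → ℕ
δ x y = suc (length (gca x y))

-- Finite sets are given by their increasing enumerations (lists).

πL : ∀ {n} → List (Vec Bool n) → List ℕ
πL (x ∷ y ∷ r) = δ x y ∷ πL (y ∷ r)
πL _           = []

SizedSubset : (a b s : ℕ) → List ℕ → Set
SizedSubset a b s J = Linked _<_ J × length J ≡ s × All (λ j → a ≤ j × j ≤ b) J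

LeftComb : ∀ {n} → List (Vec Bool n) → Set
LeftComb X = 3 ≤ length X × Linked _>_ (πL X)

RightComb : ∀ {n} → List (Vec Bool n) → Set
RightComb X = 3 ≤ length X × Linked _<_ (πL X)

bitAt : ∀ {n} → ℕ → Vec Bool n → Bool
bitAt _       []      = false
bitAt zero    (b ∷ _) = b
bitAt (suc m) (_ ∷ s) = bitAt m s

lastOr : ∀ {A : Set} → A → List A → A
lastOr d []      = d
lastOr _ (y ∷ r) = lastOr y r

-- length of the string u_X = a(min X, max X)  (X increasing)
uLen : ∀ {n} → List (Vec Bool n) → ℕ
uLen []      = 0
uLen (x ∷ r) = length (gca x (lastOr x r))

XL : ∀ {n} → List (Vec Bool n) → List (Vec Bool n)
XL X = filter (λ x → not (bitAt (uLen X) x) Data.Bool.≟ true) X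

XR : ∀ {n} → List (Vec Bool n) → List (Vec Bool n)
XR X = filter (λ x → bitAt (uLen X) x Data.Bool.≟ true) X

_-₄_ : Fin 4 → Fin 4 → Fin 4
a -₄ b = (toℕ a + (4 ∸ toℕ b)) mod 4

three : Fin 4
three = fs (fs (fs fz))

χ : ∀ {N} (k : ℕ) (c : List ℕ → Fin 4) → List (Vec Bool N) → Fin 4
χ k c X with linked? _>?_ (πL X) ×-dec (3 ≤? length X)
                 | linked? _<?_ (πL X) ×-dec (3 ≤? length X)
... | yes _ | _     = three -₄ c (reverse (πL X))
... | no _  | yes _ = c (πL X)
... | no _  | no _  with (2 ≤? length (XL X)) ×-dec (2 ≤? length (XR X))
                       | (length (XL X) ≟ k ∸ 1) ×-dec (length (XR X) ≟ 1)
                       | (length (XL X) ≟ 1) ×-dec (length (XR X) ≟ k ∸ 1)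
...   | yes _ | _     | _     = fz
...   | no _  | yes _ | _     = fs fz
...   | no _  | no _  | yes _ = fs (fs fz)
...   | no _  | no _  | no _  = fz   -- unreachable for k-sets, k ≥ 4

-- The family F^{(k')}_{I''}(n'), with vertices in ℕ (natural order).
-- x i = x_i (0 ≤ i ≤ n'), xJ J = x_J for J ∈ {2,…,n'}^{(k'-1)}; x_{I''} = x_0.

Distinguished : (n' : ℕ) → (ℕ → ℕ) → List ℕ
Distinguished n' x = map x (upTo (suc n'))

record InFamily (k' n' : ℕ) (I'' : List ℕ) (x : ℕ → ℕ) (xJ : List ℕ → ℕ) : Set where
  field
    k'≥3     : 3 ≤ k'
    n'≥3     : 3 ≤ n'
    I''-sub  : SizedSubset 1 n' (k' ∸ 1) I''
    1∈I''    : Data.List.Membership.Propositional._∈_ 1 I''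
    distinct : Linked _<_ (Distinguished n' x)
    between  : ∀ J → SizedSubset 2 n' (k' ∸ 1) J → x 0 ≤ xJ J × xJ J ≤ x 1

edgeJ : (ℕ → ℕ) → (List ℕ → ℕ) → List ℕ → List ℕ
edgeJ x xJ J = xJ J ∷ map x J

edgeI : (ℕ → ℕ) → List ℕ → List ℕ
edgeI x I'' = x 0 ∷ map x I''

maxL : List ℕ → ℕ
maxL = Data.List.foldr Data.Nat._⊔_ 0

removeMax : List ℕ → List ℕ
removeMax I = filter (λ j → Relation.Nullary.¬? (j ≟ maxL I)) I

{-# OPTIONS --safe #-}
module Submission where

-- Write x_i = δ(y_i, y_{i+1}), so that π(Y) = {x_0 < … < x_{ℓ-1}}. On leaves δ is an
-- ultrametric: δ(x,z) = min(δ(x,y), δ(y,z)) for x ≤ y ≤ z. As Y is a right comb this gives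
-- δ(y_i, y_j) = x_i for all i < j, so π of any subsequence y_{j_1} < … < y_{j_t} of Y is
-- x_{j_1} < … < x_{j_{t-1}}. For J ∈ {2,…,ℓ-1}^{(k-2)} and w = y_{J∪{ℓ}} ∈ [y_0, y_1] the
-- k-set {w} ∪ {y_j : j ∈ J ∪ {ℓ}} therefore has π = {x_J} ∪ {x_j : j ∈ J} with
-- x_J = δ(w, y_{min J}) ∈ [x_0, x_1]; it is again a right comb, so its colour α is c of
-- that set. Likewise, since a(y_I, y_1) = u_Y, the set for I has π = {x_0} ∪ {x_i : i ∈ I'}.

open import Defs
open import Data.Nat using (ℕ; zero; suc; _+_; _≤_; _<_; _∸_; _^_; _⊓_; _⊔_; z≤n; s≤s; _<′_; <′-base; <′-step)
open import Data.Nat.Properties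
open import Data.Bool using (Bool; true; false)
open import Data.Vec using (Vec; []; _∷_)
open import Data.List using (List; []; _∷_; _∷ʳ_; _++_; [_]; map; upTo; applyUpTo; length; filter; initLast; _∷ʳ′_)
open import Data.List.Properties using (map-upTo; length-++; filter-++; filter-all; filter-none; ++-identityʳ)
open import Data.List.Relation.Unary.Linked using (Linked; []; [-]; _∷_; linked?)
import Data.List.Relation.Unary.Linked as Linked
open import Data.List.Relation.Unary.Linked.Properties using (Linked⇒All)
open import Data.List.Relation.Unary.All using (All; []; _∷_)
import Data.List.Relation.Unary.All as All
import Data.List.Relation.Unary.All.Properties as All
open import Data.List.Relation.Unary.Any using (here; there)
open import Data.List.Membership.Propositional using (_∈_)
open import Data.Fin using (Fin)
open import Data.Product using (_×_; Σ; ∃₂; _,_; proj₁; proj₂)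
open import Function using (_∘_)
open import Relation.Binary.Definitions using (Transitive)
open import Relation.Nullary using (¬_; ¬?; yes; no; _×-dec_; contradiction)
open import Relation.Binary.PropositionalEquality using (_≡_; refl; sym; trans; cong; cong₂; subst; module ≡-Reasoning)

module _ {A : Set} {R : A → A → Set} where

  Linked-map-upTo⁻ : ∀ f n → Linked R (map f (upTo n)) → ∀ {i} → suc i < n → R (f i) (f (suc i))
  Linked-map-upTo⁻ f n lk = applyUpTo⁻ f n (subst (Linked R) (map-upTo f n) lk)
    where
    applyUpTo⁻ : ∀ f n → Linked R (applyUpTo f n) → ∀ {i} → suc i < n → R (f i) (f (suc i))
    applyUpTo⁻ f (suc (suc n)) (r ∷ _) {zero}  _          = r
    applyUpTo⁻ f (suc zero)    _       {zero}  (s≤s ())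
    applyUpTo⁻ f (suc n)       lk      {suc i} (s≤s i<n) = applyUpTo⁻ (f ∘ suc) n (Linked.tail lk) i<n

  Linked-∷ʳ⁺ : ∀ {xs z} → Linked R xs → All (λ x → R x z) xs → Linked R (xs ∷ʳ z)
  Linked-∷ʳ⁺ []       []       = [-]
  Linked-∷ʳ⁺ [-]      (r ∷ []) = r ∷ [-]
  Linked-∷ʳ⁺ (r ∷ lk) (_ ∷ rs) = r ∷ Linked-∷ʳ⁺ lk rs

  Linked-∷ʳ⁻ : Transitive R → ∀ xs {z} → Linked R (xs ∷ʳ z) → Linked R xs × All (λ x → R x z) xs
  Linked-∷ʳ⁻ R-trans []           _        = [] , []
  Linked-∷ʳ⁻ R-trans (x ∷ [])     (r ∷ _)  = [-] , r ∷ []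
  Linked-∷ʳ⁻ R-trans (x ∷ y ∷ xs) (r ∷ lk) with Linked-∷ʳ⁻ R-trans (y ∷ xs) lk
  ... | lk′ , rs@(ryz ∷ _) = r ∷ lk′ , R-trans r ryz ∷ rs

module _ {A : Set} {R : A → A → Set} (R-trans : Transitive R) (f : ℕ → A) {n : ℕ}
         (step : ∀ {i} → suc i < n → R (f i) (f (suc i))) where

  stepwise⇒monotone : ∀ {i j} → i < j → j < n → R (f i) (f j)
  stepwise⇒monotone i<j = go (≤⇒≤′ i<j)
    where
    go : ∀ {i j} → i <′ j → j < n → R (f i) (f j)
    go <′-base        j<n = step j<n
    go (<′-step i<′j) j<n = R-trans (go i<′j (<-trans (n<1+n _) j<n)) (step j<n)

Linked<-head≤ : ∀ {a l v} → Linked _<_ (a ∷ l) → v ∈ a ∷ l → a ≤ v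
Linked<-head≤ _          (here refl)  = ≤-refl
Linked<-head≤ (a<b ∷ lk) (there v∈l) = <⇒≤ (All.lookup (Linked⇒All <-trans a<b lk) v∈l)

sizedSubset-∷ʳ⁺ : ∀ {a b s J} → SizedSubset a b s J → a ≤ suc b → SizedSubset a (suc b) (suc s) (J ∷ʳ suc b)
sizedSubset-∷ʳ⁺ {J = J} (lk , len , bd) a≤1+b =
  Linked-∷ʳ⁺ lk (All.map (s≤s ∘ proj₂) bd) ,
  trans (length-++ J) (trans (+-comm (length J) 1) (cong suc len)) ,
  All.∷ʳ⁺ (All.map (λ (a≤j , j≤b) → a≤j , m≤n⇒m≤1+n j≤b) bd) (a≤1+b , ≤-refl)

sizedSubset-∷ʳ⁻ : ∀ {a b s I m} → SizedSubset a (suc b) (suc s) (I ∷ʳ m) → SizedSubset a b s I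
sizedSubset-∷ʳ⁻ {I = I} (lk , len , bd) =
  proj₁ lk⁻ ,
  suc-injective (trans (sym (trans (length-++ I) (+-comm (length I) 1))) len) ,
  All.zipWith (λ ((a≤i , _) , i<m) → a≤i , ≤-pred (<-≤-trans i<m m≤1+b)) (bdI , proj₂ lk⁻)
  where
  lk⁻ = Linked-∷ʳ⁻ <-trans I lk
  bdI = proj₁ (All.∷ʳ⁻ bd)
  m≤1+b = proj₂ (proj₂ (All.∷ʳ⁻ bd))

sizedSubset∋1-shape : ∀ {b s I} → SizedSubset 1 b (suc (suc s)) I → 1 ∈ I → ∃₂ λ I′ m → I ≡ (1 ∷ I′) ∷ʳ m
sizedSubset∋1-shape {I = I} _ _ with initLast I
sizedSubset∋1-shape (_ , () , _) _ | []
sizedSubset∋1-shape (_ , () , _) _ | [] ∷ʳ′ m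
sizedSubset∋1-shape (lk , _ , bd) 1∈I | (a ∷ I′) ∷ʳ′ m =
  I′ , m , cong (λ a → (a ∷ I′) ∷ʳ m) (≤-antisym (Linked<-head≤ lk 1∈I) (proj₁ (All.head bd)))

maxL-∷ʳ : ∀ xs {z} → All (_≤ z) xs → maxL (xs ∷ʳ z) ≡ z
maxL-∷ʳ []       []            = ⊔-identityʳ _
maxL-∷ʳ (x ∷ xs) (x≤z ∷ xs≤z) = trans (cong (x ⊔_) (maxL-∷ʳ xs xs≤z)) (m≤n⇒m⊔n≡n x≤z)

removeMax-∷ʳ : ∀ xs {z} → Linked _<_ (xs ∷ʳ z) → removeMax (xs ∷ʳ z) ≡ xs
removeMax-∷ʳ xs {z} lk = remove (maxL-∷ʳ xs (All.map <⇒≤ xs<z))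
  where
  xs<z = proj₂ (Linked-∷ʳ⁻ <-trans xs lk)
  remove : ∀ {m} → m ≡ z → filter (λ j → ¬? (j ≟ m)) (xs ∷ʳ z) ≡ xs
  remove refl = begin
    filter ≢z? (xs ++ [ z ])                ≡⟨ filter-++ ≢z? xs [ z ] ⟩
    filter ≢z? xs ++ filter ≢z? [ z ]       ≡⟨ cong₂ _++_ (filter-all ≢z? (All.map <⇒≢ xs<z))
                                                         (filter-none ≢z? ((λ z≢z → z≢z refl) ∷ [])) ⟩
    xs ++ []                                ≡⟨ ++-identityʳ xs ⟩
    xs                                      ∎
    where
    open ≡-Reasoning
    ≢z? = λ j → ¬? (j ≟ z)

val<2^n : ∀ {n} (s : Vec Bool n) → val s < 2 ^ n
val<2^n []                  = s≤s z≤n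
val<2^n {suc n} (false ∷ s) = ≤-trans (val<2^n s) (m≤m+n (2 ^ n) (2 ^ n + 0))
val<2^n {suc n} (true ∷ s)  = +-monoʳ-< (2 ^ n) (≤-trans (val<2^n s) (m≤m+n _ 0))

true∷≰ᴸfalse∷ : ∀ {n} (s t : Vec Bool n) → ¬ ((true ∷ s) ≤ᴸ (false ∷ t))
true∷≰ᴸfalse∷ {n} s t = <⇒≱ (<-≤-trans (val<2^n t) (m≤m+n (2 ^ n) (val s)))

<ᴸ⇒δ≤ : ∀ {n} (x y : Vec Bool n) → x <ᴸ y → δ x y ≤ n
<ᴸ⇒δ≤ []          []          ()
<ᴸ⇒δ≤ (false ∷ x) (false ∷ y) x<y = s≤s (<ᴸ⇒δ≤ x y x<y)
<ᴸ⇒δ≤ {suc n} (true ∷ x) (true ∷ y) x<y = s≤s (<ᴸ⇒δ≤ x y (+-cancelˡ-< (2 ^ n) _ _ x<y))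
<ᴸ⇒δ≤ (false ∷ x) (true ∷ y)  _   = s≤s z≤n
<ᴸ⇒δ≤ (true ∷ x)  (false ∷ y) _   = s≤s z≤n

δ-ultrametric : ∀ {n} (x y z : Vec Bool n) → x ≤ᴸ y → y ≤ᴸ z → δ x z ≡ δ x y ⊓ δ y z
δ-ultrametric []          []          []          _ _ = refl
δ-ultrametric (false ∷ x) (false ∷ y) (false ∷ z) p q = cong suc (δ-ultrametric x y z p q)
δ-ultrametric {suc n} (true ∷ x) (true ∷ y) (true ∷ z) p q =
  cong suc (δ-ultrametric x y z (+-cancelˡ-≤ (2 ^ n) _ _ p) (+-cancelˡ-≤ (2 ^ n) _ _ q))
δ-ultrametric (false ∷ x) (false ∷ y) (true ∷ z)  _ _ = refl
δ-ultrametric (false ∷ x) (true ∷ y)  (true ∷ z)  _ _ = refl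
δ-ultrametric (false ∷ x) (true ∷ y)  (false ∷ z) _ q = contradiction q (true∷≰ᴸfalse∷ y z)
δ-ultrametric (true ∷ x)  (false ∷ y) _           p _ = contradiction p (true∷≰ᴸfalse∷ x y)
δ-ultrametric (true ∷ x)  (true ∷ y)  (false ∷ z) _ q = contradiction q (true∷≰ᴸfalse∷ y z)

spine : ∀ {N} → (ℕ → Leaf N) → ℕ → ℕ
spine y i = δ (y i) (y (suc i))

πL-map-upTo : ∀ {N} (y : ℕ → Leaf N) n → πL (map y (upTo (suc n))) ≡ map (spine y) (upTo n)
πL-map-upTo y n = begin
  πL (map y (upTo (suc n)))   ≡⟨ cong πL (map-upTo y (suc n)) ⟩
  πL (applyUpTo y (suc n))    ≡⟨ πL-applyUpTo y n ⟩
  applyUpTo (spine y) n       ≡⟨ map-upTo (spine y) n ⟨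
  map (spine y) (upTo n)      ∎
  where
  open ≡-Reasoning
  πL-applyUpTo : ∀ {N} (y : ℕ → Leaf N) n → πL (applyUpTo y (suc n)) ≡ applyUpTo (spine y) n
  πL-applyUpTo y zero    = refl
  πL-applyUpTo y (suc n) = cong (spine y 0 ∷_) (πL-applyUpTo (y ∘ suc) n)

πL-bounds : ∀ {N} {X : List (Leaf N)} → Linked _<ᴸ_ X → All (λ v → 1 ≤ v × v ≤ N) (πL X)
πL-bounds []                           = []
πL-bounds [-]                          = []
πL-bounds {X = x ∷ y ∷ _} (x<y ∷ lk) = (s≤s z≤n , <ᴸ⇒δ≤ x y x<y) ∷ πL-bounds lk

rightComb⇒¬leftComb : ∀ {N} (X : List (Leaf N)) → RightComb X → ¬ LeftComb X
rightComb⇒¬leftComb (_ ∷ _ ∷ _ ∷ _) (_ , p ∷ _) (_ , q ∷ _) = <-asym p q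
rightComb⇒¬leftComb (_ ∷ [])         (s≤s () , _)
rightComb⇒¬leftComb (_ ∷ _ ∷ [])     (s≤s (s≤s ()) , _)

πL-2≤length : ∀ {N} (X : List (Leaf N)) → 2 ≤ length (πL X) → 3 ≤ length X
πL-2≤length (_ ∷ _ ∷ _ ∷ _) _        = s≤s (s≤s (s≤s z≤n))
πL-2≤length (_ ∷ _ ∷ [])    (s≤s ())

χ-rightComb : ∀ {N} k c (X : List (Leaf N)) → RightComb X → χ k c X ≡ c (πL X)
χ-rightComb k c X rc@(3≤len , lk)
  with linked? _>?_ (πL X) ×-dec (3 ≤? length X) | linked? _<?_ (πL X) ×-dec (3 ≤? length X)
... | yes (lk> , 3≤len′) | _     = contradiction (3≤len′ , lk>) (rightComb⇒¬leftComb X rc)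
... | no _               | yes _ = refl
... | no _               | no ¬rc = contradiction (lk , 3≤len) ¬rc

module RightCombSpine {N} (n : ℕ) (y : ℕ → Leaf N)
  (increasing : Linked _<ᴸ_ (map y (upTo (suc n))))
  (comb : Linked _<_ (πL (map y (upTo (suc n))))) where

  y-step : ∀ {i} → i < n → y i <ᴸ y (suc i)
  y-step i<n = Linked-map-upTo⁻ y (suc n) increasing (s≤s i<n)

  y-mono : ∀ {i j} → i < j → j ≤ n → y i <ᴸ y j
  y-mono i<j j≤n = stepwise⇒monotone {R = _<ᴸ_} <-trans y (Linked-map-upTo⁻ y (suc n) increasing) i<j (s≤s j≤n)

  spine-mono : ∀ {i j} → i < j → j < n → spine y i < spine y j
  spine-mono = stepwise⇒monotone {R = _<_} <-trans (spine y)
    (Linked-map-upTo⁻ (spine y) n (subst (Linked _<_) (πL-map-upTo y n) comb))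

  δ≡spine : ∀ {i j} → i < j → j ≤ n → δ (y i) (y j) ≡ spine y i
  δ≡spine = go ∘ ≤⇒≤′
    where
    go : ∀ {i j} → i <′ j → j ≤ n → δ (y i) (y j) ≡ spine y i
    go <′-base                    _   = refl
    go {i} (<′-step {j} i<′j) j<n = begin
      δ (y i) (y (suc j))         ≡⟨ δ-ultrametric (y i) (y j) (y (suc j)) (<⇒≤ (y-mono i<j (<⇒≤ j<n))) (<⇒≤ (y-step j<n)) ⟩
      δ (y i) (y j) ⊓ spine y j   ≡⟨ cong (_⊓ spine y j) (go i<′j (<⇒≤ j<n)) ⟩
      spine y i ⊓ spine y j       ≡⟨ m≤n⇒m⊓n≡m (<⇒≤ (spine-mono i<j j<n)) ⟩
      spine y i                   ∎
      where
      open ≡-Reasoning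
      i<j = ≤′⇒≤ i<′j

  πL-∷ʳ : ∀ l {z} → Linked _<_ (l ∷ʳ z) → All (_≤ n) (l ∷ʳ z) → πL (map y (l ∷ʳ z)) ≡ map (spine y) l
  πL-∷ʳ []          _           _               = refl
  πL-∷ʳ (a ∷ [])    (a<z ∷ _)  (_ ∷ z≤ ∷ [])   = cong (_∷ []) (δ≡spine a<z z≤)
  πL-∷ʳ (a ∷ b ∷ l) (a<b ∷ lk) (_ ∷ bd)        = cong₂ _∷_ (δ≡spine a<b (All.head bd)) (πL-∷ʳ (b ∷ l) lk bd)

  spine-linked : ∀ {l} → Linked _<_ l → All (_< n) l → Linked _<_ (map (spine y) l)
  spine-linked []         _        = []
  spine-linked [-]        _        = [-]
  spine-linked (a<b ∷ lk) (_ ∷ bd) = spine-mono a<b (All.head bd) ∷ spine-linked lk bd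

  χ-cone : ∀ k c v j J {z} → Linked _<_ ((j ∷ J) ∷ʳ z) → All (_≤ n) ((j ∷ J) ∷ʳ z) → δ v (y j) < spine y j →
           χ k c (v ∷ map y ((j ∷ J) ∷ʳ z)) ≡ c (δ v (y j) ∷ map (spine y) (j ∷ J))
  χ-cone k c v j J {z} lk bd v<j = begin
    χ k c X         ≡⟨ χ-rightComb k c X (πL-2≤length X (subst ((2 ≤_) ∘ length) (sym π≡) (s≤s (s≤s z≤n))) ,
                                          subst (Linked _<_) (sym π≡) linked) ⟩
    c (πL X)        ≡⟨ cong c π≡ ⟩
    c (δ v (y j) ∷ map (spine y) (j ∷ J)) ∎
    where
    open ≡-Reasoning
    X = v ∷ map y ((j ∷ J) ∷ʳ z)
    π≡ : πL X ≡ δ v (y j) ∷ map (spine y) (j ∷ J)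
    π≡ = cong (δ v (y j) ∷_) (πL-∷ʳ (j ∷ J) lk bd)
    lk⁻ = Linked-∷ʳ⁻ <-trans (j ∷ J) lk
    linked = v<j ∷ spine-linked (proj₁ lk⁻) (All.map (λ i<z → <-≤-trans i<z (proj₂ (All.∷ʳ⁻ {xs = j ∷ J} bd))) (proj₂ lk⁻))

  δ-between : ∀ {w j} → y 0 ≤ᴸ w → w ≤ᴸ y 1 → 2 ≤ j → j ≤ n → spine y 0 ≤ δ w (y j) × δ w (y j) ≤ spine y 1
  δ-between {w} {j} y0≤w w≤y1 2≤j j≤n = lower , upper
    where
    open ≤-Reasoning
    y1<yj = y-mono 2≤j j≤n
    lower = begin
      spine y 0                  ≡⟨ δ≡spine (≤-trans (s≤s z≤n) 2≤j) j≤n ⟨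
      δ (y 0) (y j)              ≡⟨ δ-ultrametric (y 0) w (y j) y0≤w (≤-trans w≤y1 (<⇒≤ y1<yj)) ⟩
      δ (y 0) w ⊓ δ w (y j)      ≤⟨ m⊓n≤n _ _ ⟩
      δ w (y j)                  ∎
    upper = begin
      δ w (y j)                  ≡⟨ δ-ultrametric w (y 1) (y j) w≤y1 (<⇒≤ y1<yj) ⟩
      δ w (y 1) ⊓ δ (y 1) (y j)  ≡⟨ cong (δ w (y 1) ⊓_) (δ≡spine 2≤j j≤n) ⟩
      δ w (y 1) ⊓ spine y 1      ≤⟨ m⊓n≤n _ _ ⟩
      spine y 1                  ∎

  χ-edgeI : ∀ k c {v I′ m s} → δ v (y 1) ≡ spine y 0 → SizedSubset 1 n s ((1 ∷ I′) ∷ʳ m) →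
            χ k c (v ∷ map y ((1 ∷ I′) ∷ʳ m)) ≡ c (edgeI (spine y) (removeMax ((1 ∷ I′) ∷ʳ m)))
  χ-edgeI k c {v} {I′} {m} v-at-root (lk , _ , bd) = begin
    χ k c (v ∷ map y ((1 ∷ I′) ∷ʳ m))                ≡⟨ χ-cone k c v 1 I′ lk (All.map proj₂ bd) v<spine₁ ⟩
    c (δ v (y 1) ∷ map (spine y) (1 ∷ I′))           ≡⟨ cong₂ (λ a I″ → c (a ∷ map (spine y) I″))
                                                              v-at-root (sym (removeMax-∷ʳ (1 ∷ I′) lk)) ⟩
    c (edgeI (spine y) (removeMax ((1 ∷ I′) ∷ʳ m)))  ∎
    where
    open ≡-Reasoning
    1<m = All.head (proj₂ (Linked-∷ʳ⁻ <-trans (1 ∷ I′) lk))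
    m≤n = proj₂ (proj₂ (All.∷ʳ⁻ {xs = 1 ∷ I′} bd))
    v<spine₁ = subst (_< spine y 1) (sym v-at-root) (spine-mono (s≤s z≤n) (<-≤-trans 1<m m≤n))

  module Apex {w j J s} (w-between : y 0 ≤ᴸ w × w ≤ᴸ y 1) (sJ : SizedSubset 2 n s ((j ∷ J) ∷ʳ n)) where
    private
      2≤j : 2 ≤ j
      2≤j = proj₁ (All.head (proj₂ (proj₂ sJ)))
      j<n : j < n
      j<n = All.head (proj₂ (Linked-∷ʳ⁻ <-trans (j ∷ J) (proj₁ sJ)))

    between : spine y 0 ≤ δ w (y j) × δ w (y j) ≤ spine y 1
    between = δ-between (proj₁ w-between) (proj₂ w-between) 2≤j (<⇒≤ j<n)

    δ≤N : δ w (y j) ≤ N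
    δ≤N = <ᴸ⇒δ≤ w (y j) (≤-<-trans (proj₂ w-between) (y-mono 2≤j (<⇒≤ j<n)))

    χ-edgeJ : ∀ k c → χ k c (w ∷ map y ((j ∷ J) ∷ʳ n)) ≡ c (δ w (y j) ∷ map (spine y) (j ∷ J))
    χ-edgeJ k c = χ-cone k c w j J (proj₁ sJ) (All.map proj₂ (proj₂ (proj₂ sJ)))
                    (≤-<-trans (proj₂ between) (spine-mono 2≤j j<n))

proposition2p8 : (N ℓ k : ℕ) → 4 ≤ k → k ≤ ℓ → ℓ ≤ N →
    (I : List ℕ) → SizedSubset 1 ℓ (k ∸ 1) I → 1 ∈ I →
    (c : List ℕ → Fin 4) →
    (y : ℕ → Vec Bool N) →
    Linked _<ᴸ_ (map y (upTo (suc ℓ))) →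
    RightComb (map y (upTo (suc ℓ))) →
    (yJ : List ℕ → Vec Bool N) →
    (∀ J → SizedSubset 2 ℓ (k ∸ 1) J → (y 0 ≤ᴸ yJ J) × (yJ J ≤ᴸ y 1)) →
    (yI : Vec Bool N) → y 0 ≤ᴸ yI → yI <ᴸ y 1 → gca yI (y 1) ≡ gca (y 0) (y 1) →
    (α : Fin 4) →
    (∀ J → SizedSubset 2 ℓ (k ∸ 1) J → χ k c (yJ J ∷ map y J) ≡ α) →
    χ k c (yI ∷ map y I) ≡ α →
    Σ (ℕ → ℕ) λ x → Σ (List ℕ → ℕ) λ xJ →
      InFamily (k ∸ 1) (ℓ ∸ 1) (removeMax I) x xJ
      × All (λ v → 1 ≤ v × v ≤ N) (Distinguished (ℓ ∸ 1) x)
      × (∀ J → SizedSubset 2 (ℓ ∸ 1) ((k ∸ 1) ∸ 1) J → (1 ≤ xJ J) × (xJ J ≤ N))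
      × (∀ J → SizedSubset 2 (ℓ ∸ 1) ((k ∸ 1) ∸ 1) J → c (edgeJ x xJ J) ≡ α)
      × c (edgeI x (removeMax I)) ≡ α
      × (∀ m → (m ∈ Distinguished (ℓ ∸ 1) x → m ∈ πL (map y (upTo (suc ℓ))))
             × (m ∈ πL (map y (upTo (suc ℓ))) → m ∈ Distinguished (ℓ ∸ 1) x))
proposition2p8 N ℓ@(suc L) k (s≤s (s≤s (s≤s (s≤s _)))) (s≤s k≤L) _ I I-sub 1∈I c y y-increasing (_ , y-comb)
               yJ yJ-between yI _ _ gca-yI α χJ≡α χI≡α
  with sizedSubset∋1-shape I-sub 1∈I
... | I′ , m , refl =
  spine y , xJ , family , subst (All _) π≡ (πL-bounds y-increasing) ,
  (λ J → proj₁ ∘ proj₂ ∘ apex J) , (λ J → proj₂ ∘ proj₂ ∘ apex J) ,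
  trans (sym (χ-edgeI k c (cong (suc ∘ length) gca-yI) I-sub)) χI≡α ,
  λ v → subst (v ∈_) (sym π≡) , subst (v ∈_) π≡
  where
  open RightCombSpine ℓ y y-increasing y-comb

  π≡ : πL (map y (upTo (suc ℓ))) ≡ map (spine y) (upTo ℓ)
  π≡ = πL-map-upTo y ℓ

  3≤L : 3 ≤ L
  3≤L = ≤-trans (s≤s (s≤s (s≤s z≤n))) k≤L

  xJ : List ℕ → ℕ
  xJ []      = 0
  xJ (j ∷ J) = δ (yJ ((j ∷ J) ∷ʳ ℓ)) (y j)

  apex : ∀ J → SizedSubset 2 L (k ∸ 1 ∸ 1) J →
         (spine y 0 ≤ xJ J × xJ J ≤ spine y 1) × (1 ≤ xJ J × xJ J ≤ N) × c (edgeJ (spine y) xJ J) ≡ α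
  apex []      (_ , () , _)
  apex (j ∷ J) sJ = between , (s≤s z≤n , δ≤N) , trans (sym (χ-edgeJ k c)) (χJ≡α _ sJ′)
    where
    sJ′ = sizedSubset-∷ʳ⁺ sJ (≤-trans (s≤s (s≤s z≤n)) (m≤n⇒m≤1+n 3≤L))
    open Apex (yJ-between _ sJ′) sJ′

  removeMax-I : removeMax ((1 ∷ I′) ∷ʳ m) ≡ 1 ∷ I′
  removeMax-I = removeMax-∷ʳ (1 ∷ I′) (proj₁ I-sub)

  family : InFamily (k ∸ 1) L (removeMax ((1 ∷ I′) ∷ʳ m)) (spine y) xJ
  family = record
    { k'≥3     = s≤s (s≤s (s≤s z≤n))
    ; n'≥3     = 3≤L
    ; I''-sub  = subst (SizedSubset 1 L (k ∸ 1 ∸ 1)) (sym removeMax-I) (sizedSubset-∷ʳ⁻ I-sub)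
    ; 1∈I''    = subst (1 ∈_) (sym removeMax-I) (here refl)
    ; distinct = subst (Linked _<_) π≡ y-comb
    ; between  = λ J → proj₁ ∘ apex J
    }
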